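{- For all integers $m\ge 3$ and $n\ge 1$, the joint sum $C_m\boxplus P_n$ is Fibonacci cordial.
   Context: The Fibonacci numbers are defined by $F_0=0$, $F_1=F_2=1$, $F_n=F_{n-1}+F_{n-2}$. For a graph $G$ with $N$ vertices, a Fibonacci cordial labeling is an injective function $f:V(G)\to\{F_0,F_1,\dots,F_N\}$ (labels $F_i$ with distinct indices are regarded as distinct labels) such that the induced edge labeling $f^*(uv)=(f(u)+f(v)) \bmod 2$ satisfies $|\varepsilon_0-\varepsilon_1|\le 1$, where $\varepsilon_i$ is the number of edges labeled $i$. A graph admitting such a labeling is called Fibonacci cordial. The joint sum $G_1\boxplus G_2$ is obtained by joining a vertex of $G_1$ to a vertex of $G_2$ by a new edge. Concretely, $C_m\boxplus P_n$ has vertices $u_1,\dots,u_m,v_1,\dots,v_n$, edges $u_iu_{i+1}$ ($1\le i\le m$, indices mod $m$) forming the cycle, edges $v_jv_{j+1}$ ($1\le j\le n-1$) forming the path, and the edge $u_mv_1$ joining the cycle to an end vertex of the path. -}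

module Defs where

open import Data.Nat using (ℕ; zero; suc; _+_; _∸_; _<_; _≤_; _<?_)
open import Relation.Nullary using (yes; no)
open import Data.Nat.DivMod using (_%_)
open import Data.Fin using (Fin; toℕ; fromℕ<)
open import Data.List using (List; []; _∷_; _++_; map; length; filter; upTo)
open import Data.Product using (_×_; _,_; proj₁; proj₂; Σ)
open import Data.Bool using (Bool; true; false)
open import Data.Nat.Properties using (_≟_)
open import Data.Integer using (ℤ; ∣_∣) renaming (_-_ to _-ℤ_; +_ to ℤ+_)
open import Function.Definitions using (Injective)
open import Relation.Binary.PropositionalEquality using (_≡_)

fib : ℕ → ℕ
fib 0 = 0
fib 1 = 1
fib (suc (suc n)) = fib (suc n) + fib n

record Graph : Set where
  field
    N     : ℕ
    edges : List (ℕ × ℕ)   -- edges as pairs of vertex indices (all < N)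

open Graph public

-- Vertex labelings: an injective choice of Fibonacci indices in {0,…,N}
-- (labels F_i with distinct indices are distinct labels).
-- Vertex indices ≥ N are never used by the graphs below; we read a
-- labeling via a ℕ-indexed lookup defaulting to 0 out of range.
labelAt : {N : ℕ} → (Fin N → Fin (suc N)) → ℕ → ℕ
labelAt {N} f v with v <? N
... | yes p = fib (toℕ (f (fromℕ< p)))
... | no _  = 0

edgeLabel : {N : ℕ} → (Fin N → Fin (suc N)) → ℕ × ℕ → ℕ
edgeLabel f (u , v) = (labelAt f u + labelAt f v) % 2

isZero : ℕ → Bool
isZero 0 = true
isZero (suc _) = false

eps0 : (G : Graph) → (Fin (N G) → Fin (suc (N G))) → ℕ
eps0 G f = length (filter (λ e → edgeLabel f e ≟ 0) (edges G))

eps1 : (G : Graph) → (Fin (N G) → Fin (suc (N G))) → ℕ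
eps1 G f = length (filter (λ e → edgeLabel f e ≟ 1) (edges G))

IsFibonacciCordialLabeling : (G : Graph) → (Fin (N G) → Fin (suc (N G))) → Set
IsFibonacciCordialLabeling G f =
  Injective _≡_ _≡_ f × ∣ ℤ+ eps0 G f -ℤ ℤ+ eps1 G f ∣ ≤ 1

FibonacciCordial : Graph → Set
FibonacciCordial G = Σ (Fin (N G) → Fin (suc (N G))) (IsFibonacciCordialLabeling G)

-- C_m ⊞ P_n: vertices u_i ↦ i-1 (1 ≤ i ≤ m), v_j ↦ m+j-1 (1 ≤ j ≤ n).
-- Edges: u_i u_{i+1} (indices mod m), v_j v_{j+1} (1 ≤ j ≤ n-1), u_m v_1.
CmJointPn : ℕ → ℕ → Graph
CmJointPn m n = record
  { N = m + n
  ; edges = cycleEdges m ++ (pathEdges ++ ((m ∸ 1 , m) ∷ []))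
  }
  where
    cycleEdges : ℕ → List (ℕ × ℕ)
    cycleEdges 0 = []
    cycleEdges (suc k) = map (λ i → (i , suc i % suc k)) (upTo (suc k))
    pathEdges : List (ℕ × ℕ)
    pathEdges = map (λ j → (m + j , m + suc j)) (upTo (n ∸ 1))

{-# OPTIONS --safe #-}
module Submission where

-- Numbering the vertices along the Hamiltonian path u₁ … uₘ v₁ … vₙ, the edges of
-- Cₘ ⊞ Pₙ are the N − 1 path edges (w, w + 1) together with the chord uₘu₁.
-- Since F_i is even iff 3 ∣ i, an edge is odd iff exactly one of its two label
-- indices is a multiple of 3. We give the last vertex the top label F_N and the
-- others a permutation of the indices inside each block of 12 consecutive vertices;
-- then parities repeat with period 12, every full block contributes exactly 6 odd
-- edges, and whether the labeling is balanced depends only on m and N modulo 12.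
-- For each of the 144 residue pairs one of three block permutations is balanced,
-- which is checked by evaluation.

open import Defs
open import Data.Nat.Base using (ℕ; zero; suc; _+_; _*_; _≤_; _<_; z≤n; s≤s; NonZero; _<ᵇ_)
open import Data.Nat.Properties
  using (_≟_; _≤?_; _<?_; allUpTo?; +-assoc; +-comm; +-suc; +-identityʳ; +-cancelˡ-≡; +-cancelʳ-≤; +-monoˡ-≤;
         ≤-refl; ≤-reflexive; ≤-trans; ≤-pred; ≤-total; <⇒≤; <-irrefl; m≤m+n; m<n⇒m<1+n;
         m≤n⇒m<n∨m≡n; m≤n+o⇒m∸n≤o; <ᵇ⇒<; module ≤-Reasoning)
open import Data.Nat.DivMod
  using (_%_; _/_; _mod_; %-distribˡ-+; m%n<n; m<n⇒m%n≡m; n%n≡0; [m+n]%n≡m%n; [m+kn]%n≡m%n; m≡m%n+[m/n]*n)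
open import Data.Nat.Divisibility using (_∣_; divides; ∣-trans; n∣m*n)
open import Data.Nat.ListAction using (sum)
open import Data.Nat.ListAction.Properties using (sum-++)
open import Data.Nat.Tactic.RingSolver using (solve-∀)
open import Data.Integer.Base using (∣_∣) renaming (+_ to ℤ+_; _-_ to _-ℤ_)
open import Data.Integer.Properties using (m-n≡m⊖n; ∣⊖∣-≤; ∣m⊖n∣≡∣n⊖m∣)
open import Data.Bool.Base using (Bool; _∧_; if_then_else_; T)
open import Data.Bool.Properties using (T?; T-∧)
open import Data.Fin using (Fin; toℕ; fromℕ<; #_)
open import Data.Fin.Properties using (toℕ<n; toℕ-fromℕ<; toℕ-injective; all?) renaming (_≟_ to _≟ᶠ_)
open import Data.Vec.Base using (Vec; []; _∷_; lookup)
open import Data.List.Base using (List; []; _∷_; _++_; map; length; filter; applyUpTo; upTo)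
open import Data.List.Properties using (map-++; map-upTo; map-applyUpTo; length-++; length-map; length-upTo)
open import Data.Product.Base using (_×_; _,_; proj₁; proj₂)
open import Data.Sum.Base using (inj₁; inj₂)
open import Data.Empty using (⊥-elim)
open import Function.Base using (_∘_)
open import Function.Bundles using (Equivalence)
open import Function.Definitions using (Injective)
open import Relation.Nullary using (yes; no)
open import Relation.Nullary.Decidable using (Dec; True; toWitness; _→-dec_)
open import Relation.Binary.PropositionalEquality
  using (_≡_; refl; sym; trans; cong; cong₂; subst; module ≡-Reasoning)

fibParity : ℕ → ℕ
fibParity 0 = 0
fibParity 1 = 1
fibParity 2 = 1
fibParity (suc (suc (suc k))) = fibParity k

fibParity-rec : ∀ k → fibParity (suc (suc k)) ≡ (fibParity (suc k) + fibParity k) % 2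
fibParity-rec 0 = refl
fibParity-rec 1 = refl
fibParity-rec 2 = refl
fibParity-rec (suc (suc (suc k))) = fibParity-rec k

fib%2≡fibParity : ∀ k → fib k % 2 ≡ fibParity k
fib%2≡fibParity 0 = refl
fib%2≡fibParity 1 = refl
fib%2≡fibParity (suc (suc k)) = begin
  (fib (suc k) + fib k) % 2
    ≡⟨ %-distribˡ-+ (fib (suc k)) (fib k) 2 ⟩
  (fib (suc k) % 2 + fib k % 2) % 2
    ≡⟨ cong₂ (λ x y → (x + y) % 2) (fib%2≡fibParity (suc k)) (fib%2≡fibParity k) ⟩
  (fibParity (suc k) + fibParity k) % 2
    ≡⟨ fibParity-rec k ⟨
  fibParity (suc (suc k))
    ∎
  where open ≡-Reasoning

fibParity-remove-+ˡ : ∀ {x} t → 3 ∣ x → fibParity (x + t) ≡ fibParity t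
fibParity-remove-+ˡ t (divides q refl) = remove q
  where
  remove : ∀ q → fibParity (q * 3 + t) ≡ fibParity t
  remove zero    = refl
  remove (suc q) = remove q

sum-applyUpTo-suc : ∀ (f : ℕ → ℕ) n → sum (applyUpTo f (suc n)) ≡ sum (applyUpTo f n) + f n
sum-applyUpTo-suc f zero    = +-identityʳ (f 0)
sum-applyUpTo-suc f (suc n) = trans (cong (f 0 +_) (sum-applyUpTo-suc (f ∘ suc) n)) (sym (+-assoc (f 0) _ _))

sum-applyUpTo-+ : ∀ (f : ℕ → ℕ) j k →
                  sum (applyUpTo f (j + k)) ≡ sum (applyUpTo f j) + sum (applyUpTo (f ∘ (j +_)) k)
sum-applyUpTo-+ f zero    k = refl
sum-applyUpTo-+ f (suc j) k = trans (cong (f 0 +_) (sum-applyUpTo-+ (f ∘ suc) j k)) (sym (+-assoc (f 0) _ _))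

applyUpTo-cong : ∀ {A : Set} {f g : ℕ → A} n → (∀ {i} → i < n → f i ≡ g i) → applyUpTo f n ≡ applyUpTo g n
applyUpTo-cong zero    f≡g = refl
applyUpTo-cong (suc n) f≡g = cong₂ _∷_ (f≡g (s≤s z≤n)) (applyUpTo-cong n (λ i<n → f≡g (s≤s i<n)))

periodic-% : ∀ {A : Set} (f : ℕ → A) p .{{_ : NonZero p}} → (∀ x → f (p + x) ≡ f x) → ∀ x → f x ≡ f (x % p)
periodic-% f p f-periodic x = trans (cong f (trans (m≡m%n+[m/n]*n x p) (+-comm (x % p) _))) (shift (x / p))
  where
  shift : ∀ q → f (q * p + x % p) ≡ f (x % p)
  shift zero    = refl
  shift (suc q) = trans (cong f (+-assoc p (q * p) (x % p))) (trans (f-periodic _) (shift q))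

module _ {A : Set} (g : A → ℕ) (g≤1 : ∀ x → g x ≤ 1) where

  length-filter-≟1≡sum : ∀ xs → length (filter (λ x → g x ≟ 1) xs) ≡ sum (map g xs)
  length-filter-≟1≡sum [] = refl
  length-filter-≟1≡sum (x ∷ xs) with g x | g≤1 x
  ... | 0           | _       = length-filter-≟1≡sum xs
  ... | 1           | _       = cong suc (length-filter-≟1≡sum xs)
  ... | suc (suc _) | s≤s ()

  length-filter-≟0+≟1≡length : ∀ xs →
    length (filter (λ x → g x ≟ 0) xs) + length (filter (λ x → g x ≟ 1) xs) ≡ length xs
  length-filter-≟0+≟1≡length [] = refl
  length-filter-≟0+≟1≡length (x ∷ xs) with g x | g≤1 x
  ... | 0           | _       = cong suc (length-filter-≟0+≟1≡length xs)
  ... | 1           | _       = trans (+-suc _ _) (cong suc (length-filter-≟0+≟1≡length xs))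
  ... | suc (suc _) | s≤s ()

edgeLabel-≤1 : ∀ {N} (f : Fin N → Fin (suc N)) e → edgeLabel f e ≤ 1
edgeLabel-≤1 f (u , v) = ≤-pred (m%n<n (labelAt f u + labelAt f v) 2)

sum-map-map-upTo : ∀ {A : Set} (c : A → ℕ) (h : ℕ → A) n →
                   sum (map c (map h (upTo n))) ≡ sum (applyUpTo (c ∘ h) n)
sum-map-map-upTo c h n = trans (cong (sum ∘ map c) (map-upTo h n)) (cong sum (map-applyUpTo h c n))

module _ (k l : ℕ) where

  private
    cycle path : List (ℕ × ℕ)
    cycle = map (λ i → (i , suc i % suc k)) (upTo (suc k))
    path  = map (λ j → (suc k + j , suc k + suc j)) (upTo l)

  sum-edges-CmJointPn : ∀ (c : ℕ × ℕ → ℕ) →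
    sum (map c (edges (CmJointPn (suc k) (suc l))))
      ≡ sum (applyUpTo (λ w → c (w , suc w)) (suc k + l)) + c (k , 0)
  sum-edges-CmJointPn c = begin
    sum (map c (cycle ++ path ++ (k , suc k) ∷ []))
      ≡⟨ trans (cong sum (map-++ c cycle _)) (sum-++ (map c cycle) _) ⟩
    sum (map c cycle) + sum (map c (path ++ (k , suc k) ∷ []))
      ≡⟨ cong₂ _+_ cycleSum (trans (cong sum (map-++ c path _)) (sum-++ (map c path) _)) ⟩
    (sum (applyUpTo e k) + c (k , 0)) + (sum (map c path) + (e k + 0))
      ≡⟨ cong (λ x → (sum (applyUpTo e k) + c (k , 0)) + (x + (e k + 0))) pathSum ⟩
    (sum (applyUpTo e k) + c (k , 0)) + (sum (applyUpTo (e ∘ (suc k +_)) l) + (e k + 0))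
      ≡⟨ regroup (sum (applyUpTo e k)) (c (k , 0)) (sum (applyUpTo (e ∘ (suc k +_)) l)) (e k) ⟩
    ((sum (applyUpTo e k) + e k) + sum (applyUpTo (e ∘ (suc k +_)) l)) + c (k , 0)
      ≡⟨ cong (λ x → (x + sum (applyUpTo (e ∘ (suc k +_)) l)) + c (k , 0)) (sum-applyUpTo-suc e k) ⟨
    (sum (applyUpTo e (suc k)) + sum (applyUpTo (e ∘ (suc k +_)) l)) + c (k , 0)
      ≡⟨ cong (_+ c (k , 0)) (sum-applyUpTo-+ e (suc k) l) ⟨
    sum (applyUpTo e (suc k + l)) + c (k , 0)
      ∎
    where
    open ≡-Reasoning
    e : ℕ → ℕ
    e w = c (w , suc w)
    regroup : ∀ a b c d → (a + b) + (c + (d + 0)) ≡ ((a + d) + c) + b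
    regroup = solve-∀
    cycleSum : sum (map c cycle) ≡ sum (applyUpTo e k) + c (k , 0)
    cycleSum = begin
      sum (map c cycle)                                                         ≡⟨ sum-map-map-upTo c _ (suc k) ⟩
      sum (applyUpTo (λ i → c (i , suc i % suc k)) (suc k))                     ≡⟨ sum-applyUpTo-suc _ k ⟩
      sum (applyUpTo (λ i → c (i , suc i % suc k)) k) + c (k , suc k % suc k)
        ≡⟨ cong₂ _+_ (cong sum (applyUpTo-cong k λ {i} i<k → cong (λ j → c (i , j)) (m<n⇒m%n≡m (s≤s i<k))))
                     (cong (λ j → c (k , j)) (n%n≡0 (suc k))) ⟩
      sum (applyUpTo e k) + c (k , 0)                                           ∎
    pathSum : sum (map c path) ≡ sum (applyUpTo (e ∘ (suc k +_)) l)
    pathSum = trans (sum-map-map-upTo c _ l)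
                    (cong sum (applyUpTo-cong l λ {j} _ → cong (λ i → c (suc k + j , i)) (+-suc (suc k) j)))

  length-edges-CmJointPn : length (edges (CmJointPn (suc k) (suc l))) ≡ suc k + suc l
  length-edges-CmJointPn = begin
    length (cycle ++ path ++ (k , suc k) ∷ [])        ≡⟨ length-++ cycle ⟩
    length cycle + length (path ++ (k , suc k) ∷ [])  ≡⟨ cong (length cycle +_) (length-++ path) ⟩
    length cycle + (length path + 1)
      ≡⟨ cong₂ (λ x y → x + (y + 1)) (trans (length-map _ (upTo (suc k))) (length-upTo (suc k)))
                                     (trans (length-map _ (upTo l)) (length-upTo l)) ⟩
    suc k + (l + 1)                                   ≡⟨ cong (suc k +_) (+-comm l 1) ⟩
    suc k + suc l                                     ∎
    where open ≡-Reasoning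

module _ {N : ℕ} (ℓ : ℕ → ℕ) (ℓ≤N : ∀ {w} → w < N → ℓ w ≤ N) where

  finLabeling : Fin N → Fin (suc N)
  finLabeling i = fromℕ< (s≤s (ℓ≤N (toℕ<n i)))

  finLabeling-injective : (∀ {w w'} → w < N → w' < N → ℓ w ≡ ℓ w' → w ≡ w') →
                          Injective _≡_ _≡_ finLabeling
  finLabeling-injective ℓ-injective {i} {j} fi≡fj = toℕ-injective (ℓ-injective (toℕ<n i) (toℕ<n j) (begin
    ℓ (toℕ i)            ≡⟨ toℕ-fromℕ< _ ⟨
    toℕ (finLabeling i)  ≡⟨ cong toℕ fi≡fj ⟩
    toℕ (finLabeling j)  ≡⟨ toℕ-fromℕ< _ ⟩
    ℓ (toℕ j)            ∎))
    where open ≡-Reasoning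

  labelAt-finLabeling : ∀ {w} → w < N → labelAt finLabeling w ≡ fib (ℓ w)
  labelAt-finLabeling {w} w<N with w <? N
  ... | yes w<N' = cong fib (trans (toℕ-fromℕ< _) (cong ℓ (toℕ-fromℕ< w<N')))
  ... | no  w≮N  = ⊥-elim (w≮N w<N)

  edgeLabel-finLabeling : ∀ {u v} → u < N → v < N →
                          edgeLabel finLabeling (u , v) ≡ (fibParity (ℓ u) + fibParity (ℓ v)) % 2
  edgeLabel-finLabeling {u} {v} u<N v<N = begin
    (labelAt finLabeling u + labelAt finLabeling v) % 2
      ≡⟨ cong₂ (λ x y → (x + y) % 2) (labelAt-finLabeling u<N) (labelAt-finLabeling v<N) ⟩
    (fib (ℓ u) + fib (ℓ v)) % 2
      ≡⟨ %-distribˡ-+ (fib (ℓ u)) (fib (ℓ v)) 2 ⟩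
    (fib (ℓ u) % 2 + fib (ℓ v) % 2) % 2
      ≡⟨ cong₂ (λ x y → (x + y) % 2) (fib%2≡fibParity (ℓ u)) (fib%2≡fibParity (ℓ v)) ⟩
    (fibParity (ℓ u) + fibParity (ℓ v)) % 2
      ∎
    where open ≡-Reasoning

module _ (σ : ℕ → ℕ) (L : ℕ) where

  topAt : ℕ → ℕ
  topAt w with w ≟ L
  ... | yes _ = suc L
  ... | no  _ = σ w

  topAt-top : topAt L ≡ suc L
  topAt-top with L ≟ L
  ... | yes _  = refl
  ... | no L≢L = ⊥-elim (L≢L refl)

  topAt-< : ∀ {w} → w < L → topAt w ≡ σ w
  topAt-< {w} w<L with w ≟ L
  ... | yes refl = ⊥-elim (<-irrefl refl w<L)
  ... | no  _    = refl

  module _ (σ≤1+ : ∀ w → σ w ≤ suc w) where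

    topAt-<-top : ∀ {w} → w < L → topAt w < suc L
    topAt-<-top {w} w<L = subst (_< suc L) (sym (topAt-< w<L)) (s≤s (≤-trans (σ≤1+ w) w<L))

    topAt-≤ : ∀ {w} → w ≤ L → topAt w ≤ suc L
    topAt-≤ w≤L with m≤n⇒m<n∨m≡n w≤L
    ... | inj₁ w<L  = <⇒≤ (topAt-<-top w<L)
    ... | inj₂ refl = ≤-reflexive topAt-top

    topAt-injective : Injective _≡_ _≡_ σ → ∀ {w w'} → w ≤ L → w' ≤ L → topAt w ≡ topAt w' → w ≡ w'
    topAt-injective σ-injective {w} {w'} w≤L w'≤L eq with m≤n⇒m<n∨m≡n w≤L | m≤n⇒m<n∨m≡n w'≤L
    ... | inj₁ w<L  | inj₁ w'<L = σ-injective (trans (sym (topAt-< w<L)) (trans eq (topAt-< w'<L)))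
    ... | inj₁ w<L  | inj₂ refl = ⊥-elim (<-irrefl (trans eq topAt-top) (topAt-<-top w<L))
    ... | inj₂ refl | inj₁ w'<L = ⊥-elim (<-irrefl (trans (sym eq) topAt-top) (topAt-<-top w'<L))
    ... | inj₂ refl | inj₂ refl = refl

toℕ-mod : ∀ w p .{{_ : NonZero p}} → toℕ (w mod p) ≡ w % p
toℕ-mod w p = toℕ-fromℕ< _

mod-periodic : ∀ p .{{_ : NonZero p}} w → (p + w) mod p ≡ w mod p
mod-periodic p w = toℕ-injective (begin
  toℕ ((p + w) mod p)  ≡⟨ toℕ-mod (p + w) p ⟩
  (p + w) % p          ≡⟨ cong (_% p) (+-comm p w) ⟩
  (w + p) % p          ≡⟨ [m+n]%n≡m%n w p ⟩
  w % p                ≡⟨ toℕ-mod w p ⟨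
  toℕ (w mod p)        ∎)
  where open ≡-Reasoning

module _ {p : ℕ} .{{_ : NonZero p}} (τ : Fin p → Fin p) where

  blockRelabel : ℕ → ℕ
  blockRelabel w = toℕ (τ (w mod p)) + w / p * p

  blockRelabel-% : ∀ w → blockRelabel w % p ≡ toℕ (τ (w mod p))
  blockRelabel-% w = trans ([m+kn]%n≡m%n _ (w / p) p) (m<n⇒m%n≡m (toℕ<n _))

  blockRelabel-injective : Injective _≡_ _≡_ τ → Injective _≡_ _≡_ blockRelabel
  blockRelabel-injective τ-injective {w} {w'} eq = begin
    w                    ≡⟨ m≡m%n+[m/n]*n w p ⟩
    w % p + w / p * p    ≡⟨ cong₂ _+_ r≡r' q≡q' ⟩
    w' % p + w' / p * p  ≡⟨ m≡m%n+[m/n]*n w' p ⟨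
    w'                   ∎
    where
    open ≡-Reasoning
    τr≡τr' : τ (w mod p) ≡ τ (w' mod p)
    τr≡τr' = toℕ-injective (trans (sym (blockRelabel-% w)) (trans (cong (_% p) eq) (blockRelabel-% w')))
    r≡r' : w % p ≡ w' % p
    r≡r' = trans (sym (toℕ-mod w p)) (trans (cong toℕ (τ-injective τr≡τr')) (toℕ-mod w' p))
    q≡q' : w / p * p ≡ w' / p * p
    q≡q' = +-cancelˡ-≡ (toℕ (τ (w mod p))) _ _ (trans eq (cong (λ t → toℕ t + w' / p * p) (sym τr≡τr')))

  blockRelabel-≤ : (∀ i → toℕ (τ i) ≤ suc (toℕ i)) → ∀ w → blockRelabel w ≤ suc w
  blockRelabel-≤ τ≤1+ w = begin
    toℕ (τ (w mod p)) + w / p * p      ≤⟨ +-monoˡ-≤ _ (τ≤1+ (w mod p)) ⟩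
    suc (toℕ (w mod p)) + w / p * p    ≡⟨ cong (λ r → suc r + w / p * p) (toℕ-mod w p) ⟩
    suc (w % p + w / p * p)            ≡⟨ cong suc (m≡m%n+[m/n]*n w p) ⟨
    suc w                              ∎
    where open ≤-Reasoning

  fibParity-blockRelabel : 3 ∣ p → ∀ w → fibParity (blockRelabel w) ≡ fibParity (toℕ (τ (w mod p)))
  fibParity-blockRelabel 3∣p w =
    trans (cong fibParity (+-comm (toℕ (τ (w mod p))) (w / p * p)))
          (fibParity-remove-+ˡ _ (∣-trans 3∣p (n∣m*n (w / p))))

data Arrangement : Set where
  arr₁ arr₂ arr₃ : Arrangement

byEvaluation : {P : Arrangement → Set} (P? : ∀ a → Dec (P a)) →
               {True (P? arr₁)} → {True (P? arr₂)} → {True (P? arr₃)} → ∀ a → P a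
byEvaluation P? {p₁} {p₂} {p₃} arr₁ = toWitness p₁
byEvaluation P? {p₁} {p₂} {p₃} arr₂ = toWitness p₂
byEvaluation P? {p₁} {p₂} {p₃} arr₃ = toWitness p₃

-- Each table rotates runs of consecutive indices by one step, so no index moves up
-- by more than one (blockLabels-≤); this keeps the top label free for the last vertex.
blockLabels : Arrangement → Vec (Fin 12) 12
blockLabels arr₁ = # 1 ∷ # 0 ∷ # 2 ∷ # 4 ∷ # 5 ∷ # 6 ∷ # 3 ∷ # 8 ∷ # 7 ∷ # 10 ∷ # 11 ∷ # 9 ∷ []
blockLabels arr₂ = # 0 ∷ # 2 ∷ # 1 ∷ # 4 ∷ # 3 ∷ # 5 ∷ # 7 ∷ # 8 ∷ # 9 ∷ # 6 ∷ # 11 ∷ # 10 ∷ []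
blockLabels arr₃ = # 1 ∷ # 2 ∷ # 3 ∷ # 0 ∷ # 5 ∷ # 4 ∷ # 7 ∷ # 6 ∷ # 8 ∷ # 10 ∷ # 9 ∷ # 11 ∷ []

blockLabels-injective : ∀ a → Injective _≡_ _≡_ (lookup (blockLabels a))
blockLabels-injective a {i} {j} = byEvaluation (λ a → all? λ i → all? λ j →
  (lookup (blockLabels a) i ≟ᶠ lookup (blockLabels a) j) →-dec (i ≟ᶠ j)) a i j

blockLabels-≤ : ∀ a i → toℕ (lookup (blockLabels a) i) ≤ suc (toℕ i)
blockLabels-≤ = byEvaluation (λ a → all? λ i → toℕ (lookup (blockLabels a) i) ≤? suc (toℕ i))

relabel : Arrangement → ℕ → ℕ
relabel a = blockRelabel (lookup (blockLabels a))

parity : Arrangement → ℕ → ℕ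
parity a w = fibParity (relabel a w)

parity-periodic : ∀ a w → parity a (12 + w) ≡ parity a w
parity-periodic a w = begin
  fibParity (relabel a (12 + w))         ≡⟨ fibParity-blockRelabel τ (divides 4 refl) (12 + w) ⟩
  fibParity (toℕ (τ ((12 + w) mod 12)))  ≡⟨ cong (fibParity ∘ toℕ ∘ τ) (mod-periodic 12 w) ⟩
  fibParity (toℕ (τ (w mod 12)))         ≡⟨ fibParity-blockRelabel τ (divides 4 refl) w ⟨
  fibParity (relabel a w)                ∎
  where
  open ≡-Reasoning
  τ = lookup (blockLabels a)

edgeParity : Arrangement → ℕ → ℕ
edgeParity a w = (parity a w + parity a (suc w)) % 2

-- Odd edges of C_(k+1) ⊞ P_(K+1−k), so N = K + 2, under the labeling built from a
-- below: the path edges (w, w + 1) with w < K, the edge (K, K + 1) into the vertex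
-- carrying F_N, and the chord (k, 0).
oddEdges : Arrangement → ℕ → ℕ → ℕ
oddEdges a k K = sum (applyUpTo (edgeParity a) K)
               + (parity a K + fibParity (suc (suc K))) % 2
               + (parity a k + parity a 0) % 2

oddEdges-periodicˡ : ∀ a k K → oddEdges a (12 + k) K ≡ oddEdges a k K
oddEdges-periodicˡ a k K = cong (λ p → _ + (p + parity a 0) % 2) (parity-periodic a k)

oddEdges-periodicʳ : ∀ a k K → oddEdges a k (12 + K) ≡ 6 + oddEdges a k K
oddEdges-periodicʳ a k K =
  cong₂ (λ s p → s + (p + fibParity (suc (suc K))) % 2 + (parity a k + parity a 0) % 2)
        blockSum (parity-periodic a K)
  where
  blockSum : sum (applyUpTo (edgeParity a) (12 + K)) ≡ 6 + sum (applyUpTo (edgeParity a) K)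
  blockSum = trans (sum-applyUpTo-+ (edgeParity a) 12 K) (cong₂ _+_
    (byEvaluation (λ a → sum (applyUpTo (edgeParity a) 12) ≟ 6) a)
    (cong sum (applyUpTo-cong K λ {w} _ →
      cong₂ (λ x y → (x + y) % 2) (parity-periodic a w) (parity-periodic a (suc w)))))

-- |N − 2e| ≤ 1, phrased with _<ᵇ_ so that shifting N by 12 and e by 6 cancels definitionally.
isBalanced : ℕ → ℕ → Bool
isBalanced N e = (e + e <ᵇ 2 + N) ∧ (N <ᵇ 2 + (e + e))

isBalanced-periodic : ∀ N e → isBalanced (12 + N) (6 + e) ≡ isBalanced N e
isBalanced-periodic N e = cong (λ d → (d <ᵇ 14 + N) ∧ (12 + N <ᵇ 2 + d)) (cong (6 +_) (+-comm e (6 + e)))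

balancedFor : Arrangement → ℕ → ℕ → Bool
balancedFor a k K = isBalanced (suc (suc K)) (oddEdges a k K)

balancedFor-periodicˡ : ∀ a K k → balancedFor a (12 + k) K ≡ balancedFor a k K
balancedFor-periodicˡ a K k = cong (isBalanced (suc (suc K))) (oddEdges-periodicˡ a k K)

balancedFor-periodicʳ : ∀ a k K → balancedFor a k (12 + K) ≡ balancedFor a k K
balancedFor-periodicʳ a k K = trans (cong (isBalanced (12 + suc (suc K))) (oddEdges-periodicʳ a k K))
                                    (isBalanced-periodic (suc (suc K)) (oddEdges a k K))

choose : ℕ → ℕ → Arrangement
choose k K = if balancedFor arr₁ k K then arr₁ else if balancedFor arr₂ k K then arr₂ else arr₃

choose-balanced-< : ∀ {k} → k < 12 → ∀ {K} → K < 12 → T (balancedFor (choose k K) k K)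
choose-balanced-< =
  toWitness {a? = allUpTo? (λ k → allUpTo? (λ K → T? (balancedFor (choose k K) k K)) 12) 12} _

choose-balanced : ∀ k K → T (balancedFor (choose (k % 12) (K % 12)) k K)
choose-balanced k K = subst T (sym (begin
    balancedFor a k K                ≡⟨ periodic-% (λ k → balancedFor a k K) 12 (balancedFor-periodicˡ a K) k ⟩
    balancedFor a (k % 12) K         ≡⟨ periodic-% (balancedFor a (k % 12)) 12 (balancedFor-periodicʳ a (k % 12)) K ⟩
    balancedFor a (k % 12) (K % 12)  ∎))
  (choose-balanced-< (m%n<n k 12) (m%n<n K 12))
  where
  open ≡-Reasoning
  a = choose (k % 12) (K % 12)

module _ (a : Arrangement) (k l : ℕ) where

  private
    G = CmJointPn (suc k) (suc l)
    K = k + l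
    L = k + suc l

    L≡1+K : L ≡ suc K
    L≡1+K = +-suc k l

    ≤K⇒<L : ∀ {w} → w ≤ K → w < L
    ≤K⇒<L {w} w≤K = subst (w <_) (sym L≡1+K) (s≤s w≤K)

    relabel-≤ : ∀ w → relabel a w ≤ suc w
    relabel-≤ = blockRelabel-≤ _ (blockLabels-≤ a)

  labelIndex : ℕ → ℕ
  labelIndex = topAt (relabel a) L

  labelIndex-≤ : ∀ {w} → w < suc L → labelIndex w ≤ suc L
  labelIndex-≤ w<N = topAt-≤ (relabel a) L relabel-≤ (≤-pred w<N)

  labeling : Fin (N G) → Fin (suc (N G))
  labeling = finLabeling labelIndex labelIndex-≤

  labeling-injective : Injective _≡_ _≡_ labeling
  labeling-injective = finLabeling-injective labelIndex labelIndex-≤ λ w<N w'<N →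
    topAt-injective (relabel a) L relabel-≤ (blockRelabel-injective _ (blockLabels-injective a))
                    (≤-pred w<N) (≤-pred w'<N)

  private
    edgeLabel-< : ∀ {u v} → u < L → v < L → edgeLabel labeling (u , v) ≡ (parity a u + parity a v) % 2
    edgeLabel-< {u} {v} u<L v<L =
      trans (edgeLabel-finLabeling labelIndex labelIndex-≤ (m<n⇒m<1+n u<L) (m<n⇒m<1+n v<L))
            (cong₂ (λ x y → (fibParity x + fibParity y) % 2)
               (topAt-< (relabel a) L u<L) (topAt-< (relabel a) L v<L))

    labelIndex-top : labelIndex (suc K) ≡ suc (suc K)
    labelIndex-top = trans (cong labelIndex (sym L≡1+K)) (trans (topAt-top (relabel a) L) (cong suc L≡1+K))

    edgeLabel-top : edgeLabel labeling (K , suc K) ≡ (parity a K + fibParity (suc (suc K))) % 2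
    edgeLabel-top =
      trans (edgeLabel-finLabeling labelIndex labelIndex-≤
               (m<n⇒m<1+n (≤K⇒<L ≤-refl)) (s≤s (≤-reflexive (sym L≡1+K))))
            (cong₂ (λ x y → (fibParity x + fibParity y) % 2)
               (topAt-< (relabel a) L (≤K⇒<L ≤-refl)) labelIndex-top)

  eps1-labeling : eps1 G labeling ≡ oddEdges a k K
  eps1-labeling = begin
    eps1 G labeling
      ≡⟨ length-filter-≟1≡sum (edgeLabel labeling) (edgeLabel-≤1 labeling) (edges G) ⟩
    sum (map (edgeLabel labeling) (edges G))
      ≡⟨ sum-edges-CmJointPn k l (edgeLabel labeling) ⟩
    sum (applyUpTo (λ w → edgeLabel labeling (w , suc w)) (suc K)) + edgeLabel labeling (k , 0)
      ≡⟨ cong (_+ edgeLabel labeling (k , 0)) (sum-applyUpTo-suc _ K) ⟩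
    sum (applyUpTo (λ w → edgeLabel labeling (w , suc w)) K)
      + edgeLabel labeling (K , suc K) + edgeLabel labeling (k , 0)
      ≡⟨ cong₂ _+_ (cong₂ _+_ pathEdges edgeLabel-top) (edgeLabel-< (≤K⇒<L (m≤m+n k l)) (≤K⇒<L z≤n)) ⟩
    oddEdges a k K
      ∎
    where
    open ≡-Reasoning
    pathEdges : sum (applyUpTo (λ w → edgeLabel labeling (w , suc w)) K) ≡ sum (applyUpTo (edgeParity a) K)
    pathEdges = cong sum (applyUpTo-cong K λ w<K → edgeLabel-< (≤K⇒<L (<⇒≤ w<K)) (≤K⇒<L w<K))

  eps0+eps1-labeling : eps0 G labeling + eps1 G labeling ≡ N G
  eps0+eps1-labeling =
    trans (length-filter-≟0+≟1≡length (edgeLabel labeling) (edgeLabel-≤1 labeling) (edges G))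
          (length-edges-CmJointPn k l)

∣-∣≤1 : ∀ {x y} → x ≤ suc y → y ≤ suc x → ∣ ℤ+ x -ℤ ℤ+ y ∣ ≤ 1
∣-∣≤1 {x} {y} x≤1+y y≤1+x rewrite m-n≡m⊖n x y with ≤-total x y
... | inj₁ x≤y = subst (_≤ 1) (sym (∣⊖∣-≤ x≤y)) (m≤n+o⇒m∸n≤o y x (subst (y ≤_) (+-comm 1 x) y≤1+x))
... | inj₂ y≤x = subst (_≤ 1) (sym (trans (∣m⊖n∣≡∣n⊖m∣ x y) (∣⊖∣-≤ y≤x)))
                       (m≤n+o⇒m∸n≤o x y (subst (x ≤_) (+-comm 1 y) x≤1+y))

balanced⇒∣-∣≤1 : ∀ {x y N} → x + y ≡ N → T (isBalanced N y) → ∣ ℤ+ x -ℤ ℤ+ y ∣ ≤ 1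
balanced⇒∣-∣≤1 {x} {y} refl balanced = ∣-∣≤1
  (+-cancelʳ-≤ y x (suc y) (≤-pred (<ᵇ⇒< _ _ (proj₂ (Equivalence.to T-∧ balanced)))))
  (+-cancelʳ-≤ y y (suc x) (≤-pred (<ᵇ⇒< _ _ (proj₁ (Equivalence.to T-∧ balanced)))))

CmJointPn-fibonacciCordial : ∀ k l → FibonacciCordial (CmJointPn (suc k) (suc l))
CmJointPn-fibonacciCordial k l = labeling a k l , labeling-injective a k l ,
  balanced⇒∣-∣≤1 {eps0 G (labeling a k l)} (trans (eps0+eps1-labeling a k l) (+-suc (suc k) l))
    (subst (λ e → T (isBalanced (suc (suc (k + l))) e)) (sym (eps1-labeling a k l)) (choose-balanced k (k + l)))
  where
  G = CmJointPn (suc k) (suc l)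
  a = choose (k % 12) ((k + l) % 12)

mainTheorem4 : (m n : ℕ) → 3 ≤ m → 1 ≤ n → FibonacciCordial (CmJointPn m n)
mainTheorem4 (suc k) (suc l) _ _  = CmJointPn-fibonacciCordial k l
mainTheorem4 zero    _       () _
mainTheorem4 (suc k) zero    _  ()
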